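{- Let $k$ be a field and let $P$ be a finite graded poset with $p$ elements having a unique minimum $\hat 0$ and a unique maximum $\hat 1$. If a polynomial $f\in k[x_1,\dots,x_N]$ is supported on $P$, then $f$ has a determinantal representation of size $p-1$, i.e. there is a $(p-1)\times(p-1)$ matrix of affine linear functions in $x_1,\dots,x_N$ whose determinant equals $f$.
   Context: Let $P$ be graded of rank $d$. A polynomial $f$ is supported on $P$ if there is a labelling of each edge $e$ of the Hasse diagram of $P$ (i.e. each cover relation) by a linear form $L_e$ in $x_1,\dots,x_N$ such that $f=\sum_C\prod_{e\in C}L_e$, where $C$ ranges over all saturated chains $\hat0\lessdot i_1\lessdot\cdots\lessdot i_{d-1}\lessdot\hat1$ of $P$ and $e\in C$ ranges over the $d$ cover relations of the chain. -}

module Defs where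

open import Level using (Level; _⊔_) renaming (suc to lsuc)
open import Data.Nat using (ℕ; zero; suc; _∸_)
open import Data.Fin using (Fin; zero; suc; punchIn; _≟_)
open import Data.Fin.Properties using (all?)
open import Data.Vec using (Vec; []; _∷_; head; last)
open import Data.List using (List; []; _∷_; foldr; map; concatMap; allFin; upTo)
open import Data.Product using (Σ; _×_; _,_; ∃)
open import Data.Unit using (⊤; tt)
open import Data.Bool using (Bool; true; false; not)
open import Relation.Nullary using (¬_; Dec; yes; no)
open import Relation.Nullary.Decidable using (_×-dec_; ¬?)
open import Relation.Binary using (IsDecPartialOrder)
open import Relation.Binary.PropositionalEquality using (_≡_)
open import Algebra.Bundles using (CommutativeRing)

record Field (c ℓ : Level) : Set (lsuc (c ⊔ ℓ)) where
  field
    commutativeRing : CommutativeRing c ℓ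
  open CommutativeRing commutativeRing public
  field
    1≉0     : ¬ (1# ≈ 0#)
    inverse : ∀ x → ¬ (x ≈ 0#) → Σ Carrier λ y → (x * y) ≈ 1#

-- The polynomial ring k[x₁,…,x_N], constructed as the term algebra
-- (constants from k, variables x_i, +, *, -) modulo the least congruence
-- making it a commutative ring in which constants form a copy of k.

module Poly {c ℓ : Level} (k : Field c ℓ) (N : ℕ) where
  private module K = Field k

  infixl 6 _+P_
  infixl 7 _*P_
  infix 4 _≈P_

  data Pol : Set c where
    con  : K.Carrier → Pol
    var  : Fin N → Pol
    _+P_ : Pol → Pol → Pol
    _*P_ : Pol → Pol → Pol
    -P_  : Pol → Pol

  0P 1P : Pol
  0P = con K.0#
  1P = con K.1#

  data _≈P_ : Pol → Pol → Set (c ⊔ ℓ) where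
    refl  : ∀ {f} → f ≈P f
    sym   : ∀ {f g} → f ≈P g → g ≈P f
    trans : ∀ {f g h} → f ≈P g → g ≈P h → f ≈P h
    +-cong : ∀ {f f' g g'} → f ≈P f' → g ≈P g' → f +P g ≈P f' +P g'
    *-cong : ∀ {f f' g g'} → f ≈P f' → g ≈P g' → f *P g ≈P f' *P g'
    neg-cong : ∀ {f f'} → f ≈P f' → -P f ≈P -P f'
    +-assoc    : ∀ f g h → (f +P g) +P h ≈P f +P (g +P h)
    +-comm     : ∀ f g → f +P g ≈P g +P f
    +-identity : ∀ f → 0P +P f ≈P f
    +-inverse  : ∀ f → (-P f) +P f ≈P 0P
    *-assoc    : ∀ f g h → (f *P g) *P h ≈P f *P (g *P h)
    *-comm     : ∀ f g → f *P g ≈P g *P f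
    *-identity : ∀ f → 1P *P f ≈P f
    distrib    : ∀ f g h → f *P (g +P h) ≈P (f *P g) +P (f *P h)
    con-cong : ∀ {a b} → a K.≈ b → con a ≈P con b
    con-+    : ∀ a b → con (a K.+ b) ≈P con a +P con b
    con-*    : ∀ a b → con (a K.* b) ≈P con a *P con b
    con--    : ∀ a → con (K.- a) ≈P -P con a

  sumL : List Pol → Pol
  sumL = foldr _+P_ 0P

  prodL : List Pol → Pol
  prodL = foldr _*P_ 1P

  sumFin : ∀ {n} → (Fin n → Pol) → Pol
  sumFin f = sumL (map f (allFin _))

  linForm : (Fin N → K.Carrier) → Pol
  linForm a = sumFin (λ i → con (a i) *P var i)

  affine : K.Carrier × (Fin N → K.Carrier) → Pol
  affine (a₀ , a) = con a₀ +P linForm a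

  signed : Bool → Pol → Pol
  signed true  f = f
  signed false f = -P f

  det : ∀ {n} → (Fin n → Fin n → Pol) → Pol
  det {zero}  M = 1P
  det {suc n} M = go true (allFin (suc n))
    where
    minor : Fin (suc n) → Fin n → Fin n → Pol
    minor j r s = M (suc r) (punchIn j s)
    go : Bool → List (Fin (suc n)) → Pol
    go b []       = 0P
    go b (j ∷ js) = signed b (M zero j *P det (minor j)) +P go (not b) js

record FinPoset (p : ℕ) : Set₁ where
  field
    _≤_        : Fin p → Fin p → Set
    isDecPartialOrder : IsDecPartialOrder _≡_ _≤_

  open IsDecPartialOrder isDecPartialOrder public using (_≤?_)

  _<_ : Fin p → Fin p → Set
  x < y = x ≤ y × ¬ (x ≡ y)

  _<?_ : ∀ x y → Dec (x < y)
  x <? y = (x ≤? y) ×-dec ¬? (x ≟ y)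

  _⋖_ : Fin p → Fin p → Set
  x ⋖ y = x < y × (∀ z → ¬ (x < z × z < y))

  _⋖?_ : ∀ x y → Dec (x ⋖ y)
  x ⋖? y = (x <? y) ×-dec all? (λ z → ¬? ((x <? z) ×-dec (z <? y)))

  IsBottom IsTop : Fin p → Set
  IsBottom b = ∀ x → b ≤ x
  IsTop    t = ∀ x → x ≤ t

module Chains {p : ℕ} (P : FinPoset p) (bot top : Fin p) where
  open FinPoset P

  Steps : ∀ {m} → Vec (Fin p) m → Set
  Steps []           = ⊤
  Steps (x ∷ [])     = ⊤
  Steps (x ∷ y ∷ xs) = x ⋖ y × Steps (y ∷ xs)

  steps? : ∀ {m} (v : Vec (Fin p) m) → Dec (Steps v)
  steps? []           = yes tt
  steps? (x ∷ [])     = yes tt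
  steps? (x ∷ y ∷ xs) = (x ⋖? y) ×-dec steps? (y ∷ xs)

  SatChain : (m : ℕ) → Vec (Fin p) (suc m) → Set
  SatChain m c = head c ≡ bot × last c ≡ top × Steps c

  satChain? : ∀ m c → Dec (SatChain m c)
  satChain? m c = (head c ≟ bot) ×-dec ((last c ≟ top) ×-dec steps? c)

  GradedOfRank : ℕ → Set
  GradedOfRank d = ∀ m c → SatChain m c → m ≡ d

  allVecs : ∀ m → List (Vec (Fin p) m)
  allVecs zero    = [] ∷ []
  allVecs (suc m) = concatMap (λ x → map (x ∷_) (allVecs m)) (allFin p)

  module _ {c ℓ : Level} (k : Field c ℓ) (N : ℕ) where
    open Poly k N
    private module K = Field k

    -- a linear form for each pair; only the values on cover relations
    -- (edges of the Hasse diagram) are ever used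
    Labelling : Set c
    Labelling = Fin p → Fin p → (Fin N → K.Carrier)

    chainProd : Labelling → ∀ {m} (v : Vec (Fin p) m) → Steps v → Pol
    chainProd L []           _        = 1P
    chainProd L (x ∷ [])     _        = 1P
    chainProd L (x ∷ y ∷ xs) (e , es) = linForm (L x y) *P chainProd L (y ∷ xs) es

    term : Labelling → ∀ m → Vec (Fin p) (suc m) → Pol
    term L m c with satChain? m c
    ... | yes (_ , _ , s) = chainProd L c s
    ... | no _            = 0P

    -- A saturated chain has at most p - 1 cover relations (its elements
    -- are distinct), so ranging over lengths m < p covers all of them.
    chainSum : Labelling → Pol
    chainSum L = sumL (map (λ m → sumL (map (term L m) (allVecs (suc m)))) (upTo p))

    SupportedOn : Pol → Set (c ⊔ ℓ)
    SupportedOn f = Σ Labelling λ L → f ≈P chainSum L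

-- Weight a pair (x, y) of P by the label of x ⋖ y, or by 0 if y does not cover x, and list P
-- along a linear extension bot = w₀, w₁, …, w_{p-1} = top.  For a list x, y₁, …, yₙ let
-- H(x; y₁ … yₙ) be the n×n lower Hessenberg matrix with first row (w(x,y₁), −1, 0, …, 0),
-- first column (w(x,y₁), …, w(x,yₙ)) and lower right block H(y₁; y₂ … yₙ).  Expanding along
-- the first row gives det H(x; y₁ … yₙ) = w(x,y₁) · det H(y₁; y₂ … yₙ) + det H(x; y₂ … yₙ),
-- so det H(bot; w₁ … w_{p-1}) is the weighted sum of the increasing paths from bot to top.
-- Only paths along covers have nonzero weight, and a walk along covers is increasing in any
-- linear extension, so this is the sum over saturated chains of the products of their labels.

module Submission where

open import Defs
open import Level using (Level; _⊔_)
open import Function.Base using (id; _∘_; _∘′_; case_of_)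
open import Algebra.Bundles using (CommutativeSemiring; CommutativeRing)
import Algebra.Consequences.Setoid as Consequences
import Algebra.Properties.Ring as RingProperties
open import Data.Bool using (Bool; true; false; not)
open import Data.Nat as ℕ using (ℕ; zero; suc; s≤s; z≤n; _∸_)
open import Data.Nat.Properties as ℕ using (m≤n⇒m≤1+n; <⇒≱)
open import Data.Fin as Fin using (Fin; zero; suc; punchIn; _≟_)
open import Data.Vec using (Vec; []; _∷_; last)
open import Data.List
  using (List; []; _∷_; _++_; map; foldr; concatMap; filter; length; lookup; allFin; tabulate; upTo; applyUpTo)
open import Data.List.Properties using (map-++; map-∘; ++-assoc; map-upTo; length-tabulate)
open import Data.List.Relation.Unary.All using (All; []; _∷_)
import Data.List.Relation.Unary.All as All
import Data.List.Relation.Unary.All.Properties as AllP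
open import Data.List.Relation.Unary.AllPairs using (AllPairs; _∷_)
import Data.List.Relation.Unary.AllPairs as AllPairs
open import Data.List.Relation.Unary.Any using (here; there)
open import Data.List.Relation.Unary.Unique.Propositional using (Unique)
open import Data.List.Relation.Unary.Unique.Propositional.Properties using (allFin⁺)
open import Data.List.Membership.Propositional using (_∈_)
open import Data.List.Membership.Propositional.Properties using (∈-allFin; ∈-++⁻)
open import Data.List.Relation.Binary.Permutation.Propositional using (_↭_; ↭-sym; ↭⇒↭ₛ; ↭⇒↭ₛ′)
open import Data.List.Relation.Binary.Permutation.Propositional.Properties using (↭-length; map⁺; ∈-resp-↭)
import Data.List.Relation.Binary.Permutation.Setoid.Properties as SetoidPerm
open import Data.List.Relation.Unary.Sorted.TotalOrder.Properties using (Sorted⇒AllPairs)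
import Data.List.Sort as Sort
open import Data.Product using (Σ; _×_; _,_; proj₁; proj₂)
open import Data.Sum using (inj₁; inj₂)
open import Data.Unit using (tt)
open import Relation.Nullary using (¬_; yes; no; contradiction)
open import Relation.Unary using (Pred; Decidable)
open import Relation.Binary.Bundles using (Setoid; DecTotalOrder)
open import Relation.Binary.Structures using (IsDecPartialOrder)
import Relation.Binary.Construct.On as On
import Relation.Binary.Construct.NonStrictToStrict as NonStrictToStrict
import Relation.Binary.PropositionalEquality as ≡
open ≡ using (_≡_; _≢_)
import Relation.Binary.Reasoning.Setoid as SetoidReasoning

private variable
  a r : Level
  A B : Set a

module ListSum {c ℓ} (R : CommutativeSemiring c ℓ) where
  open CommutativeSemiring R
  open SetoidReasoning setoid
  open import Algebra.Properties.CommutativeSemigroup +-commutativeSemigroup using (interchange)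

  sum : List Carrier → Carrier
  sum = foldr _+_ 0#

  sum-++ : ∀ xs ys → sum (xs ++ ys) ≈ sum xs + sum ys
  sum-++ []       ys = sym (+-identityˡ _)
  sum-++ (x ∷ xs) ys = trans (+-congˡ (sum-++ xs ys)) (sym (+-assoc _ _ _))

  sum-↭ : ∀ {xs ys} → xs ↭ ys → sum xs ≈ sum ys
  sum-↭ = SetoidPerm.foldr-commMonoid setoid +-isCommutativeMonoid ∘ ↭⇒↭ₛ′ isEquivalence

  sum-map-cong : ∀ {f g : A → Carrier} xs → (∀ {x} → x ∈ xs → f x ≈ g x) →
                 sum (map f xs) ≈ sum (map g xs)
  sum-map-cong []       f≈g = refl
  sum-map-cong (x ∷ xs) f≈g = +-cong (f≈g (here ≡.refl)) (sum-map-cong xs (f≈g ∘′ there))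

  sum-map-≈0 : ∀ {f : A → Carrier} {xs} → All (λ x → f x ≈ 0#) xs → sum (map f xs) ≈ 0#
  sum-map-≈0 []           = refl
  sum-map-≈0 (fx≈0 ∷ all) = trans (+-cong fx≈0 (sum-map-≈0 all)) (+-identityˡ _)

  sum-map-+ : ∀ (f g : A → Carrier) xs →
              sum (map (λ x → f x + g x) xs) ≈ sum (map f xs) + sum (map g xs)
  sum-map-+ f g []       = sym (+-identityˡ _)
  sum-map-+ f g (x ∷ xs) = trans (+-congˡ (sum-map-+ f g xs)) (interchange _ _ _ _)

  *-distribˡ-sum : ∀ c (f : A → Carrier) xs → c * sum (map f xs) ≈ sum (map (λ x → c * f x) xs)
  *-distribˡ-sum c f []       = zeroʳ c
  *-distribˡ-sum c f (x ∷ xs) = trans (distribˡ _ _ _) (+-congˡ (*-distribˡ-sum c f xs))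

  sum-map-∘ : ∀ (f : B → Carrier) (g : A → B) xs →
              sum (map f (map g xs)) ≈ sum (map (f ∘ g) xs)
  sum-map-∘ f g xs = reflexive (≡.cong sum (≡.sym (map-∘ xs)))

  sum-concatMap : ∀ (f : B → Carrier) (g : A → List B) xs →
                  sum (map f (concatMap g xs)) ≈ sum (map (λ x → sum (map f (g x))) xs)
  sum-concatMap f g []       = refl
  sum-concatMap f g (x ∷ xs) = begin
    sum (map f (g x ++ concatMap g xs))              ≡⟨ ≡.cong sum (map-++ f (g x) _) ⟩
    sum (map f (g x) ++ map f (concatMap g xs))      ≈⟨ sum-++ (map f (g x)) _ ⟩
    sum (map f (g x)) + sum (map f (concatMap g xs)) ≈⟨ +-congˡ (sum-concatMap f g xs) ⟩
    sum (map (λ x → sum (map f (g x))) (x ∷ xs))     ∎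

  sum-swap : ∀ (f : A → B → Carrier) xs ys →
             sum (map (λ x → sum (map (f x) ys)) xs) ≈ sum (map (λ y → sum (map (λ x → f x y) xs)) ys)
  sum-swap f []       ys = sym (sum-map-≈0 {xs = ys} (All.tabulate (λ _ → refl)))
  sum-swap f (x ∷ xs) ys =
    trans (+-congˡ (sum-swap f xs ys)) (sym (sum-map-+ (f x) (λ y → sum (map (λ x → f x y) xs)) ys))

  sum-map-delta : ∀ {f : A → Carrier} {xs y} → Unique xs → y ∈ xs →
                  (∀ {x} → x ≢ y → f x ≈ 0#) → sum (map f xs) ≈ f y
  sum-map-delta {xs = x ∷ xs} (x∉xs ∷ uniq) (here ≡.refl) f≈0 =
    trans (+-congˡ (sum-map-≈0 (All.map (λ x≢z → f≈0 (x≢z ∘ ≡.sym)) x∉xs))) (+-identityʳ _)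
  sum-map-delta {xs = x ∷ xs} (x∉xs ∷ uniq) (there y∈xs) f≈0 =
    trans (+-cong (f≈0 (All.lookup x∉xs y∈xs)) (sum-map-delta uniq y∈xs f≈0))
          (+-identityˡ _)


AllPairs-++⁻ : ∀ {R : A → A → Set r} xs {y ys} → AllPairs R (xs ++ y ∷ ys) →
               All (λ x → R x y) xs × All (R y) ys
AllPairs-++⁻ []       (y-ys ∷ _)       = [] , y-ys
AllPairs-++⁻ (x ∷ xs) (x-rest ∷ pairs) with AllPairs-++⁻ xs pairs
... | before , after = All.head (AllP.++⁻ʳ xs x-rest) ∷ before , after

module _ {p q} {P : Pred A p} {Q : Pred A q} (P? : Decidable P) (Q? : Decidable Q)
         (P⇒Q : ∀ {x} → P x → Q x) where

  length-filter-mono : ∀ xs → length (filter P? xs) ℕ.≤ length (filter Q? xs)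
  length-filter-mono []       = z≤n
  length-filter-mono (x ∷ xs) with P? x | Q? x
  ... | yes _  | yes _   = s≤s (length-filter-mono xs)
  ... | yes px | no ¬qx  = contradiction (P⇒Q px) ¬qx
  ... | no _   | yes _   = m≤n⇒m≤1+n (length-filter-mono xs)
  ... | no _   | no _    = length-filter-mono xs

  length-filter-mono-< : ∀ {z xs} → z ∈ xs → ¬ P z → Q z →
                         length (filter P? xs) ℕ.< length (filter Q? xs)
  length-filter-mono-< {xs = x ∷ xs} (here ≡.refl) ¬pz qz with P? x | Q? x
  ... | yes pz | _      = contradiction pz ¬pz
  ... | no _   | yes _  = s≤s (length-filter-mono xs)
  ... | no _   | no ¬qz = contradiction qz ¬qz
  length-filter-mono-< {xs = x ∷ xs} (there z∈xs) ¬pz qz with P? x | Q? x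
  ... | yes _  | yes _  = s≤s (length-filter-mono-< z∈xs ¬pz qz)
  ... | yes px | no ¬qx = contradiction (P⇒Q px) ¬qx
  ... | no _   | yes _  = ℕ.m<n⇒m<1+n (length-filter-mono-< z∈xs ¬pz qz)
  ... | no _   | no _   = length-filter-mono-< z∈xs ¬pz qz

module PolynomialRing {c ℓ} (k : Field c ℓ) (N : ℕ) where
  open Poly k N using (Pol; _+P_; _*P_; -P_; _≈P_; det; signed)
  private module P = Poly k N

  ≈P-setoid : Setoid c (c ⊔ ℓ)
  ≈P-setoid = record
    { Carrier = Pol ; _≈_ = _≈P_
    ; isEquivalence = record { refl = P.refl ; sym = P.sym ; trans = P.trans } }

  open Consequences ≈P-setoid

  commutativeRing : CommutativeRing c (c ⊔ ℓ)
  commutativeRing = record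
    { Carrier = Pol ; _≈_ = _≈P_ ; _+_ = _+P_ ; _*_ = _*P_ ; -_ = -P_ ; 0# = P.0P ; 1# = P.1P
    ; isCommutativeRing = record
      { isRing = record
        { +-isAbelianGroup = record
          { isGroup = record
            { isMonoid = record
              { isSemigroup = record
                { isMagma = record { isEquivalence = Setoid.isEquivalence ≈P-setoid ; ∙-cong = P.+-cong }
                ; assoc = P.+-assoc }
              ; identity = comm∧idˡ⇒id P.+-comm P.+-identity }
            ; inverse = comm∧invˡ⇒inv P.+-comm P.+-inverse
            ; ⁻¹-cong = P.neg-cong }
          ; comm = P.+-comm }
        ; *-cong = P.*-cong
        ; *-assoc = P.*-assoc
        ; *-identity = comm∧idˡ⇒id P.*-comm P.*-identity
        ; distrib = comm∧distrˡ⇒distr P.+-cong P.*-comm P.distrib }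
      ; *-comm = P.*-comm } }

  open CommutativeRing commutativeRing hiding (zero)
  open RingProperties ring using (-0#≈0#; -1*x≈-x; -‿involutive)
  open SetoidReasoning setoid

  minor : ∀ {n} → (Fin (suc n) → Fin (suc n) → Pol) → Fin (suc n) → Fin n → Fin n → Pol
  minor M j r s = M (suc r) (punchIn j s)

  cofactorSum : ∀ {n} → (Fin (suc n) → Fin (suc n) → Pol) → Bool → List (Fin (suc n)) → Pol
  cofactorSum M b []       = 0#
  cofactorSum M b (j ∷ js) = signed b (M zero j * det (minor M j)) + cofactorSum M (not b) js

  private
    alternatingInduction : ∀ {a p} {A : Set a} {Mot : Bool → List A → Set p} →
      (∀ b → Mot b []) → (∀ b x xs → Mot (not b) xs → Mot b (x ∷ xs)) → ∀ b xs → Mot b xs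
    alternatingInduction base step b []       = base b
    alternatingInduction {Mot = Mot} base step b (x ∷ xs) =
      step b x xs (alternatingInduction {Mot = Mot} base step (not b) xs)

  det-cofactorSum : ∀ {n} (M : Fin (suc n) → Fin (suc n) → Pol) →
                    det M ≡ cofactorSum M true (allFin (suc n))
  -- The `go` in the definition of `det` is local and cannot be named; abstracting over its
  -- arguments lets unification find the motive of the induction.
  det-cofactorSum {n} M with false | tabulate {n = n} Fin.suc
                            | alternatingInduction {p = c} (λ _ → ≡.refl) (λ _ _ _ → ≡.cong (_ +_))
  ... | b | js | go≡cofactorSum = ≡.cong (_ +_) (go≡cofactorSum b js)

  signed-cong : ∀ b {f g} → f ≈ g → signed b f ≈ signed b g
  signed-cong true  f≈g = f≈g
  signed-cong false f≈g = -‿cong f≈g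

  signed-≈0 : ∀ b {f} → f ≈ 0# → signed b f ≈ 0#
  signed-≈0 true  f≈0 = f≈0
  signed-≈0 false f≈0 = trans (-‿cong f≈0) -0#≈0#

  det-cong : ∀ {n} {M M′ : Fin n → Fin n → Pol} → (∀ i j → M i j ≈ M′ i j) → det M ≈ det M′
  det-cong {zero}          M≈M′ = refl
  det-cong {suc n} {M} {M′} M≈M′ = begin
    det M                                   ≡⟨ det-cofactorSum M ⟩
    cofactorSum M true (allFin (suc n))     ≈⟨ cofactorSum-cong true (allFin (suc n)) ⟩
    cofactorSum M′ true (allFin (suc n))    ≡⟨ det-cofactorSum M′ ⟨
    det M′                                  ∎
    where
    cofactorSum-cong : ∀ b js → cofactorSum M b js ≈ cofactorSum M′ b js
    cofactorSum-cong b []       = refl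
    cofactorSum-cong b (j ∷ js) =
      +-cong (signed-cong b (*-cong (M≈M′ zero j) (det-cong (λ r s → M≈M′ (suc r) (punchIn j s)))))
             (cofactorSum-cong (not b) js)

  cofactorSum-≈0 : ∀ {n} {M : Fin (suc n) → Fin (suc n) → Pol} b {js} →
                   All (λ j → M zero j ≈ 0#) js → cofactorSum M b js ≈ 0#
  cofactorSum-≈0 b []            = refl
  cofactorSum-≈0 b (Mj≈0 ∷ all) =
    trans (+-cong (signed-≈0 b (trans (*-congʳ Mj≈0) (zeroˡ _))) (cofactorSum-≈0 (not b) all))
          (+-identityˡ _)

  det-hessenbergRow : ∀ {n} (M : Fin (suc (suc n)) → Fin (suc (suc n)) → Pol) →
                      (∀ j → M zero (suc (suc j)) ≈ 0#) →
                      det M ≈ M zero zero * det (minor M zero) - M zero (suc zero) * det (minor M (suc zero))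
  det-hessenbergRow M row≈0 = begin
    det M  ≡⟨ det-cofactorSum M ⟩
    M zero zero * det (minor M zero) + (- (M zero (suc zero) * det (minor M (suc zero))) + cofactorSum M true _)
      ≈⟨ +-congˡ (+-congˡ (cofactorSum-≈0 true (AllP.tabulate⁺ row≈0))) ⟩
    M zero zero * det (minor M zero) + (- (M zero (suc zero) * det (minor M (suc zero))) + 0#)
      ≈⟨ +-congˡ (+-identityʳ _) ⟩
    M zero zero * det (minor M zero) - M zero (suc zero) * det (minor M (suc zero)) ∎

  module PathMatrix {ℓₑ ℓₓ} {E : Set ℓₑ} {X : Set ℓₓ} (entry : X → Pol) (weight : E → E → X)
                    (-𝟙 𝟘 : X) (entry-𝟙 : entry -𝟙 ≈ - 1#) (entry-𝟘 : entry 𝟘 ≈ 0#) where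

    pathMatrix : E → (ys : List E) → Fin (length ys) → Fin (length ys) → X
    pathMatrix x (y ∷ ys)    zero    zero          = weight x y
    pathMatrix x (y ∷ [])    zero    (suc ())
    pathMatrix x (y ∷ _ ∷ _) zero    (suc zero)    = -𝟙
    pathMatrix x (y ∷ _ ∷ _) zero    (suc (suc _)) = 𝟘
    pathMatrix x (y ∷ ys)    (suc r) zero          = weight x (lookup ys r)
    pathMatrix x (y ∷ ys)    (suc r) (suc s)       = pathMatrix y ys r s

    pathSum stepSum : E → List E → Pol
    pathSum x []         = 1#
    pathSum x ys@(_ ∷ _) = stepSum x ys
    stepSum x []       = 0#
    stepSum x (y ∷ ys) = entry (weight x y) * pathSum y ys + stepSum x ys

    pathMatrix-minor₁ : ∀ x y z zs r s →
      pathMatrix x (y ∷ z ∷ zs) (suc r) (punchIn (suc zero) s) ≡ pathMatrix x (z ∷ zs) r s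
    pathMatrix-minor₁ x y z zs       zero    zero             = ≡.refl
    pathMatrix-minor₁ x y z zs       (suc r) zero             = ≡.refl
    pathMatrix-minor₁ x y z (_ ∷ zs) zero    (suc zero)       = ≡.refl
    pathMatrix-minor₁ x y z (_ ∷ zs) zero    (suc (suc s))    = ≡.refl
    pathMatrix-minor₁ x y z zs       (suc r) (suc s)          = ≡.refl

    det-pathMatrix : ∀ x ys → det (λ i j → entry (pathMatrix x ys i j)) ≈ pathSum x ys
    det-pathMatrix x []           = refl
    det-pathMatrix x (y ∷ [])     = refl
    det-pathMatrix x (y ∷ z ∷ zs) = begin
      det M
        ≈⟨ det-hessenbergRow M (λ _ → entry-𝟘) ⟩
      entry (weight x y) * det (minor M zero) - entry -𝟙 * det (minor M (suc zero))
        ≈⟨ +-cong (*-congˡ (det-pathMatrix y (z ∷ zs)))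
                  (-‿cong (*-cong entry-𝟙 (det-cong λ r s →
                    reflexive (≡.cong entry (pathMatrix-minor₁ x y z zs r s))))) ⟩
      entry (weight x y) * pathSum y (z ∷ zs) - (- 1#) * det (λ r s → entry (pathMatrix x (z ∷ zs) r s))
        ≈⟨ +-congˡ (-‿cong (*-congˡ (det-pathMatrix x (z ∷ zs)))) ⟩
      entry (weight x y) * pathSum y (z ∷ zs) - (- 1#) * stepSum x (z ∷ zs)
        ≈⟨ +-congˡ (trans (-‿cong (-1*x≈-x _)) (-‿involutive _)) ⟩
      stepSum x (y ∷ z ∷ zs) ∎
      where
      M : Fin (length (y ∷ z ∷ zs)) → Fin (length (y ∷ z ∷ zs)) → Pol
      M i j = entry (pathMatrix x (y ∷ z ∷ zs) i j)

module LinearExtension {p} (P : FinPoset p) where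
  open FinPoset P
  open IsDecPartialOrder isDecPartialOrder using (isPartialOrder)
  open NonStrictToStrict _≡_ _≤_ using (<-trans; <-irrefl)

  record IsLinearExtension (w : List (Fin p)) : Set where
    field
      enumerates : w ↭ allFin p
      unique     : Unique w
      monotone   : AllPairs (λ x y → ¬ y < x) w

  height : Fin p → ℕ
  height x = length (filter (_<? x) (allFin p))

  height-mono-< : ∀ {x y} → x < y → height x ℕ.< height y
  height-mono-< {x} x<y = length-filter-mono-< (_<? _) (_<? _)
    (λ z<x → <-trans isPartialOrder z<x x<y) (∈-allFin x) (<-irrefl ≡.refl) x<y

  heightOrder : DecTotalOrder _ _ _
  heightOrder = On.decTotalOrder ℕ.≤-decTotalOrder height

  open Sort heightOrder using (sort; sort-↭; sort-↗)

  linearExtension : List (Fin p)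
  linearExtension = sort (allFin p)

  linearExtension-isLinearExtension : IsLinearExtension linearExtension
  linearExtension-isLinearExtension = record
    { enumerates = sort-↭ (allFin p)
    ; unique     = SetoidPerm.Unique-resp-↭ (≡.setoid _) (↭⇒↭ₛ (↭-sym (sort-↭ (allFin p)))) (allFin⁺ p)
    ; monotone   = AllPairs.map (λ hx≤hy y<x → <⇒≱ (height-mono-< y<x) hx≤hy)
                     (Sorted⇒AllPairs (DecTotalOrder.totalOrder heightOrder) (sort-↗ (allFin p)))
    }


module ChainSums {c ℓ} (k : Field c ℓ) (N : ℕ) {p} (P : FinPoset p) (bot top : Fin p)
                 (L : Chains.Labelling P bot top k N) where
  open Poly k N using (Pol; linForm; affine; det)
  private module P = Poly k N
  private module K = Field k
  open PolynomialRing k N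
  open CommutativeRing commutativeRing hiding (zero)
  open ListSum commutativeSemiring
  open SetoidReasoning setoid
  open FinPoset P
  open Chains P bot top
  open LinearExtension P using (IsLinearExtension)
  open NonStrictToStrict _≡_ _≤_ using (<-irrefl)

  Affine : Set c
  Affine = K.Carrier × (Fin N → K.Carrier)

  zeroForm : Fin N → K.Carrier
  zeroForm _ = K.0#

  linForm-zeroForm : linForm zeroForm ≈ 0#
  linForm-zeroForm = sum-map-≈0 {xs = allFin N} (All.tabulate (λ _ → zeroˡ _))

  coverWeight : Fin p → Fin p → Affine
  coverWeight x y with x ⋖? y
  ... | yes _ = K.0# , L x y
  ... | no _  = K.0# , zeroForm

  weight : Fin p → Fin p → Pol
  weight x y = affine (coverWeight x y)

  weight-cover : ∀ {x y} → x ⋖ y → weight x y ≈ linForm (L x y)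
  weight-cover {x} {y} x⋖y with x ⋖? y
  ... | yes _    = +-identityˡ _
  ... | no ¬x⋖y  = contradiction x⋖y ¬x⋖y

  weight-noncover : ∀ {x y} → ¬ x ⋖ y → weight x y ≈ 0#
  weight-noncover {x} {y} ¬x⋖y with x ⋖? y
  ... | yes x⋖y = contradiction x⋖y ¬x⋖y
  ... | no _    = trans (+-identityˡ _) linForm-zeroForm

  atTop : Fin p → Pol
  atTop x with x ≟ top
  ... | yes _ = 1#
  ... | no _  = 0#

  atTop-≡ : ∀ {x} → x ≡ top → atTop x ≈ 1#
  atTop-≡ {x} x≡top with x ≟ top
  ... | yes _    = refl
  ... | no x≢top = contradiction x≡top x≢top

  atTop-≢ : ∀ {x} → x ≢ top → atTop x ≈ 0#
  atTop-≢ {x} x≢top with x ≟ top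
  ... | yes x≡top = contradiction x≡top x≢top
  ... | no _      = refl

  walkWeight : ∀ {m} → Vec (Fin p) (suc m) → Pol
  walkWeight (x ∷ [])     = atTop x
  walkWeight (x ∷ y ∷ xs) = weight x y * walkWeight (y ∷ xs)

  walkWeight-chain : ∀ {m} (v : Vec (Fin p) (suc m)) (s : Steps v) → last v ≡ top →
                     walkWeight v ≈ chainProd k N L v s
  walkWeight-chain (x ∷ [])     _          x≡top = atTop-≡ x≡top
  walkWeight-chain (x ∷ y ∷ xs) (x⋖y , s) last≡top =
    *-cong (weight-cover x⋖y) (walkWeight-chain (y ∷ xs) s last≡top)

  walkWeight-≈0 : ∀ {m} (v : Vec (Fin p) (suc m)) → ¬ (Steps v × last v ≡ top) → walkWeight v ≈ 0#
  walkWeight-≈0 (x ∷ []) ¬chain = atTop-≢ (λ x≡top → ¬chain (tt , x≡top))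
  walkWeight-≈0 (x ∷ y ∷ xs) ¬chain = case x ⋖? y of λ where
    (yes x⋖y) → trans (*-congˡ (walkWeight-≈0 (y ∷ xs) (λ (s , e) → ¬chain ((x⋖y , s) , e)))) (zeroʳ _)
    (no ¬x⋖y) → trans (*-congʳ (weight-noncover ¬x⋖y)) (zeroˡ _)

  term-bot : ∀ m xs → term k N L m (bot ∷ xs) ≈ walkWeight (bot ∷ xs)
  term-bot m xs with satChain? m (bot ∷ xs)
  ... | yes (_ , last≡top , s) = sym (walkWeight-chain (bot ∷ xs) s last≡top)
  ... | no ¬sat                 = sym (walkWeight-≈0 (bot ∷ xs) (λ (s , e) → ¬sat (≡.refl , e , s)))

  term-≢bot : ∀ {x} m xs → x ≢ bot → term k N L m (x ∷ xs) ≈ 0#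
  term-≢bot {x} m xs x≢bot with satChain? m (x ∷ xs)
  ... | yes (x≡bot , _) = contradiction x≡bot x≢bot
  ... | no _            = refl

  walks : ℕ → Fin p → Pol
  walks m x = sum (map (λ xs → walkWeight (x ∷ xs)) (allVecs m))

  chainSum≈walks : chainSum k N L ≈ sum (map (λ m → walks m bot) (upTo p))
  chainSum≈walks = sum-map-cong (upTo p) λ {m} _ → begin
    sum (map (term k N L m) (allVecs (suc m)))
      ≈⟨ sum-concatMap (term k N L m) (λ x → map (x ∷_) (allVecs m)) (allFin p) ⟩
    sum (map (λ x → sum (map (term k N L m) (map (x ∷_) (allVecs m)))) (allFin p))
      ≈⟨ sum-map-delta (allFin⁺ p) (∈-allFin bot) (λ x≢bot →
           trans (sum-map-∘ _ _ (allVecs m))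
                 (sum-map-≈0 {xs = allVecs m} (All.tabulate λ {xs} _ → term-≢bot m xs x≢bot))) ⟩
    sum (map (term k N L m) (map (bot ∷_) (allVecs m)))
      ≈⟨ sum-map-∘ _ _ (allVecs m) ⟩
    sum (map (λ xs → term k N L m (bot ∷ xs)) (allVecs m))
      ≈⟨ sum-map-cong (allVecs m) (λ {xs} _ → term-bot m xs) ⟩
    walks m bot ∎

  walks-suc : ∀ m x → walks (suc m) x ≈ sum (map (λ y → weight x y * walks m y) (allFin p))
  walks-suc m x = begin
    walks (suc m) x
      ≈⟨ sum-concatMap (λ xs → walkWeight (x ∷ xs)) (λ y → map (y ∷_) (allVecs m)) (allFin p) ⟩
    sum (map (λ y → sum (map (λ xs → walkWeight (x ∷ xs)) (map (y ∷_) (allVecs m)))) (allFin p))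
      ≈⟨ sum-map-cong (allFin p) (λ {y} _ →
           trans (sum-map-∘ _ (y ∷_) (allVecs m)) (sym (*-distribˡ-sum (weight x y) _ (allVecs m)))) ⟩
    sum (map (λ y → weight x y * walks m y) (allFin p)) ∎

  walksBelow : ℕ → Fin p → Pol
  walksBelow K x = sum (map (λ m → walks m x) (upTo K))

  walksBelow-suc : ∀ K x →
    walksBelow (suc K) x ≈ atTop x + sum (map (λ y → weight x y * walksBelow K y) (allFin p))
  walksBelow-suc K x = +-cong (+-identityʳ _) (begin
    sum (map (λ m → walks m x) (applyUpTo suc K))
      ≡⟨ ≡.cong (sum ∘ map _) (map-upTo suc K) ⟨
    sum (map (λ m → walks m x) (map suc (upTo K)))
      ≈⟨ sum-map-∘ _ suc (upTo K) ⟩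
    sum (map (λ m → walks (suc m) x) (upTo K))
      ≈⟨ sum-map-cong (upTo K) (λ {m} _ → walks-suc m x) ⟩
    sum (map (λ m → sum (map (λ y → weight x y * walks m y) (allFin p))) (upTo K))
      ≈⟨ sum-swap (λ m y → weight x y * walks m y) (upTo K) (allFin p) ⟩
    sum (map (λ y → sum (map (λ m → weight x y * walks m y) (upTo K))) (allFin p))
      ≈⟨ sum-map-cong (allFin p) (λ {y} _ → sym (*-distribˡ-sum (weight x y) _ (upTo K))) ⟩
    sum (map (λ y → weight x y * walksBelow K y) (allFin p)) ∎)

  entry-𝟙 : affine (K.- K.1# , zeroForm) ≈ - 1#
  entry-𝟙 = trans (+-congˡ linForm-zeroForm) (trans (+-identityʳ _) (P.con-- K.1#))

  entry-𝟘 : affine (K.0# , zeroForm) ≈ 0#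
  entry-𝟘 = trans (+-congˡ linForm-zeroForm) (+-identityʳ _)

  open PathMatrix affine coverWeight (K.- K.1# , zeroForm) (K.0# , zeroForm) entry-𝟙 entry-𝟘

  module Walk (isBot : IsBottom bot) (isTop : IsTop top) {w} (lin : IsLinearExtension w) where
    open IsLinearExtension lin

    member : ∀ x → x ∈ w
    member x = ∈-resp-↭ (↭-sym enumerates) (∈-allFin x)

    length-w : length w ≡ p
    length-w = ≡.trans (↭-length enumerates) (length-tabulate id)

    monotoneAt : ∀ pre {x post} → pre ++ x ∷ post ≡ w →
                 All (λ y → ¬ x < y) pre × All (λ y → ¬ y < x) post
    monotoneAt pre eq = AllPairs-++⁻ pre (≡.subst (AllPairs _) (≡.sym eq) monotone)

    distinctAt : ∀ pre {x post} → pre ++ x ∷ post ≡ w → All (x ≢_) post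
    distinctAt pre eq = proj₂ (AllPairs-++⁻ pre (≡.subst Unique (≡.sym eq) unique))

    head≡bot : ∀ {x rest} → x ∷ rest ≡ w → x ≡ bot
    head≡bot {x} eq with x ≟ bot
    ... | yes x≡bot = x≡bot
    ... | no x≢bot with ≡.subst (bot ∈_) (≡.sym eq) (member bot)
    ...   | here bot≡x     = contradiction (≡.sym bot≡x) x≢bot
    ...   | there bot∈rest =
            contradiction (isBot x , x≢bot ∘ ≡.sym) (All.lookup (proj₂ (monotoneAt [] eq)) bot∈rest)

    last≡top : ∀ pre {x} → pre ++ x ∷ [] ≡ w → x ≡ top
    last≡top pre {x} eq with x ≟ top
    ... | yes x≡top = x≡top
    ... | no x≢top with ∈-++⁻ pre (≡.subst (top ∈_) (≡.sym eq) (member top))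
    ...   | inj₁ top∈pre      =
            contradiction (isTop x , x≢top) (All.lookup (proj₁ (monotoneAt pre eq)) top∈pre)
    ...   | inj₂ (here top≡x) = contradiction (≡.sym top≡x) x≢top

    nonLast≢top : ∀ pre {x y ys} → pre ++ x ∷ y ∷ ys ≡ w → x ≢ top
    nonLast≢top pre {y = y} eq ≡.refl =
      contradiction (isTop y , All.head (distinctAt pre eq) ∘ ≡.sym) (All.head (proj₂ (monotoneAt pre eq)))

    atTop+stepSum : ∀ pre {x post} → pre ++ x ∷ post ≡ w → atTop x + stepSum x post ≈ pathSum x post
    atTop+stepSum pre {post = []}    eq = trans (+-identityʳ _) (atTop-≡ (last≡top pre eq))
    atTop+stepSum pre {post = _ ∷ _} eq = trans (+-congʳ (atTop-≢ (nonLast≢top pre eq))) (+-identityˡ _)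

    sum-forward : ∀ pre {x post} (g : Fin p → Pol) → pre ++ x ∷ post ≡ w →
      sum (map (λ y → weight x y * g y) (allFin p)) ≈ sum (map (λ y → weight x y * g y) post)
    sum-forward pre {x} {post} g eq = begin
      sum (map h (allFin p))                      ≈⟨ sum-↭ (map⁺ h (↭-sym enumerates)) ⟩
      sum (map h w)                               ≡⟨ ≡.cong (sum ∘ map h) eq ⟨
      sum (map h (pre ++ x ∷ post))               ≡⟨ ≡.cong sum (map-++ h pre (x ∷ post)) ⟩
      sum (map h pre ++ map h (x ∷ post))         ≈⟨ sum-++ (map h pre) (map h (x ∷ post)) ⟩
      sum (map h pre) + (h x + sum (map h post))
        ≈⟨ +-cong (sum-map-≈0 (All.map vanish (proj₁ (monotoneAt pre eq))))
                  (+-congʳ (vanish (<-irrefl ≡.refl))) ⟩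
      0# + (0# + sum (map h post))                ≈⟨ trans (+-identityˡ _) (+-identityˡ _) ⟩
      sum (map h post)                            ∎
      where
      h : Fin p → Pol
      h y = weight x y * g y
      vanish : ∀ {y} → ¬ x < y → h y ≈ 0#
      vanish ¬x<y = trans (*-congʳ (weight-noncover (¬x<y ∘ proj₁))) (zeroˡ _)

    walksBelow≈pathSum : ∀ K pre {x post} → pre ++ x ∷ post ≡ w → length post ℕ.< K →
                         walksBelow K x ≈ pathSum x post
    walksBelow≈pathSum (suc K) pre {x} {post} eq (s≤s |post|≤K) = begin
      walksBelow (suc K) x
        ≈⟨ walksBelow-suc K x ⟩
      atTop x + sum (map (λ y → weight x y * walksBelow K y) (allFin p))
        ≈⟨ +-congˡ (sum-forward pre _ eq) ⟩
      atTop x + sum (map (λ y → weight x y * walksBelow K y) post)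
        ≈⟨ +-congˡ (laterSteps (pre ++ x ∷ []) post (≡.trans (++-assoc pre (x ∷ []) post) eq) |post|≤K) ⟩
      atTop x + stepSum x post
        ≈⟨ atTop+stepSum pre eq ⟩
      pathSum x post ∎
      where
      laterSteps : ∀ pre′ ys → pre′ ++ ys ≡ w → length ys ℕ.≤ K →
              sum (map (λ y → weight x y * walksBelow K y) ys) ≈ stepSum x ys
      laterSteps pre′ []       _   _      = refl
      laterSteps pre′ (y ∷ ys) eq′ |ys|<K = +-cong (*-congˡ (walksBelow≈pathSum K pre′ eq′ |ys|<K))
        (laterSteps (pre′ ++ y ∷ []) ys (≡.trans (++-assoc pre′ (y ∷ []) ys) eq′) (ℕ.<⇒≤ |ys|<K))

    pathSum≈chainSum : ∀ {x rest} → x ∷ rest ≡ w → pathSum x rest ≈ chainSum k N L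
    pathSum≈chainSum {x} {rest} eq = begin
      pathSum x rest    ≈⟨ walksBelow≈pathSum p [] eq |rest|<p ⟨
      walksBelow p x    ≡⟨ ≡.cong (walksBelow p) (head≡bot eq) ⟩
      walksBelow p bot  ≈⟨ chainSum≈walks ⟨
      chainSum k N L    ∎
      where
      |rest|<p : length rest ℕ.< p
      |rest|<p = ℕ.≤-reflexive (≡.trans (≡.cong length eq) length-w)

  DeterminantalRepresentation : ℕ → Set (c ⊔ ℓ)
  DeterminantalRepresentation n =
    Σ (Fin n → Fin n → Affine) λ M → det (λ i j → affine (M i j)) ≈ chainSum k N L

  representation : IsBottom bot → IsTop top → ∀ w → IsLinearExtension w →
                   DeterminantalRepresentation (p ∸ 1)
  representation isBot isTop [] lin with Walk.member isBot isTop lin bot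
  ... | ()
  representation isBot isTop (x ∷ rest) lin =
    ≡.subst DeterminantalRepresentation (≡.cong (_∸ 1) length-w)
            (pathMatrix x rest , trans (det-pathMatrix x rest) (pathSum≈chainSum ≡.refl))
    where open Walk isBot isTop lin

proposition2p1 : ∀ {c ℓ : Level} (k : Field c ℓ) (N : ℕ)
    {p : ℕ} (P : FinPoset p) (bot top : Fin p) (d : ℕ) →
    FinPoset.IsBottom P bot → FinPoset.IsTop P top →
    Chains.GradedOfRank P bot top d →
    (f : Poly.Pol k N) → Chains.SupportedOn P bot top k N f →
    Σ (Fin (p ∸ 1) → Fin (p ∸ 1) → Field.Carrier k × (Fin N → Field.Carrier k))
      (λ M → Poly._≈P_ k N (Poly.det k N (λ i j → Poly.affine k N (M i j))) f)
proposition2p1 k N P bot top _ isBot isTop _ f (L , f≈chainSum) =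
  let M , det≈chainSum = ChainSums.representation k N P bot top L isBot isTop
                           (LinearExtension.linearExtension P) (LinearExtension.linearExtension-isLinearExtension P)
  in M , Poly.trans det≈chainSum (Poly.sym f≈chainSum)
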